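{- Let $\lambda,\mu$ be strict partitions with $\mu\subseteq\lambda$, and let $\mathcal{C}^*$ be the configuration of $0$'s produced by the algorithm below. Then for every configuration $\mathcal{C}$ of $0$'s for $\lambda/\mu$, $\kappa(\mathcal{C}^*)\le\kappa(\mathcal{C})$.
   Context: Let $S(\lambda)$ be the shifted diagram of $\lambda$ (row $i$ of the Young diagram shifted $i-1$ squares right). A configuration $\mathcal{C}$ of $0$'s for $\lambda/\mu$ assigns to each row $i$ an integer $z_i$ with $0\le z_i\le\lambda_i$ (the leftmost $z_i$ squares of row $i$ are filled with $0$, the other squares blank), such that the nonzero $z_i$'s, arranged in decreasing order, are exactly the parts of $\mu$. Let $o_r$ (resp. $e_r$) be the number of rows with $z_i=0$ and $\lambda_i$ odd (resp. even), and $o_s$ (resp. $e_s$) the number of rows with $z_i>0$ and $\lambda_i-z_i$ odd (resp. even and nonzero). Define $\kappa(\mathcal{C})=o_s+2e_s+\max\big(o_r,\ e_r+((e_r+o_r)\bmod 2)\big)$. Algorithm: start with all rows blank and $J=\{1,\dots,\ell(\lambda)\}$. For $i=1,2,\dots,\ell(\mu)$: (A) if $\mu_i=\lambda_j$ for some $j\in J$, fill row $j$ entirely with $0$'s; (B) otherwise, (B1) if $\lambda_j-\mu_i$ is odd and positive for some $j\in J$, take the largest such index $j$ and fill the leftmost $\mu_i$ squares of row $j$ with $0$'s; (B2) if $\lambda_j-\mu_i$ is even for every $j\in J$ with $\lambda_j>\mu_i$, take the largest index $j\in J$ with $\lambda_j>\mu_i$ and fill the leftmost $\mu_i$ squares of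 row $j$ with $0$'s. Then remove $j$ from $J$. The resulting configuration is $\mathcal{C}^*$. -}

module Defs where

open import Data.Nat using (ℕ; zero; suc; _+_; _*_; _∸_; _≤_; _<_; _⊔_; _%_; _≡ᵇ_; _<ᵇ_; _<?_)
open import Data.Bool using (Bool; true; false; _∧_; not; if_then_else_)
open import Data.List using (List; []; _∷_; length; take; zip; upTo; filter; filterᵇ; map)
open import Data.Bool.ListAction using (any)
open import Data.Maybe using (Maybe; just; nothing; _<∣>_)
import Data.Maybe as Maybe
open import Data.Product using (_×_; _,_)
open import Data.List.Relation.Unary.All using (All)
open import Data.List.Relation.Unary.Linked using (Linked)
open import Data.List.Relation.Binary.Pointwise using (Pointwise)
open import Data.List.Relation.Binary.Permutation.Propositional using (_↭_)

StrictPartition : List ℕ → Set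
StrictPartition p = Linked (λ a b → b < a) p × All (λ a → 0 < a) p

-- Containment of (shifted) diagrams: ℓ(μ) ≤ ℓ(λ) and μ_i ≤ λ_i for i ≤ ℓ(μ).
-- (Pointwise forces length μ = length (take (length μ) λ), i.e. ℓ(μ) ≤ ℓ(λ).)
_⊆ₚ_ : List ℕ → List ℕ → Set
mu ⊆ₚ la = Pointwise _≤_ mu (take (length mu) la)

-- A configuration of 0's for λ/μ: z = (z_1,…,z_ℓ(λ)) with 0 ≤ z_i ≤ λ_i and the
-- multiset of nonzero z_i equal to the parts of μ (μ strict, so sorting them
-- decreasingly gives μ exactly when they are a permutation of μ).
IsConfiguration : List ℕ → List ℕ → List ℕ → Set
IsConfiguration la mu z = Pointwise _≤_ z la × (filter (0 <?_) z ↭ mu)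

isOdd : ℕ → Bool
isOdd n = (n % 2) ≡ᵇ 1

countRows : (ℕ → ℕ → Bool) → List ℕ → List ℕ → ℕ
countRows p (l ∷ ls) (z ∷ zs) = (if p l z then 1 else 0) + countRows p ls zs
countRows p _ _ = 0

oR eR oS eS : List ℕ → List ℕ → ℕ
oR = countRows (λ l z → (z ≡ᵇ 0) ∧ isOdd l)
eR = countRows (λ l z → (z ≡ᵇ 0) ∧ not (isOdd l))
oS = countRows (λ l z → not (z ≡ᵇ 0) ∧ isOdd (l ∸ z))
eS = countRows (λ l z → not (z ≡ᵇ 0) ∧ (not (isOdd (l ∸ z)) ∧ not ((l ∸ z) ≡ᵇ 0)))

κ : List ℕ → List ℕ → ℕ
κ la z = oS la z + 2 * eS la z + (oR la z ⊔ (eR la z + ((eR la z + oR la z) % 2)))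

-- The algorithm (rows indexed 0,…,ℓ(λ)-1 internally).

rowsOf : List ℕ → List (ℕ × ℕ)
rowsOf la = zip (upTo (length la)) la

firstIdx : (ℕ → Bool) → List (ℕ × ℕ) → Maybe ℕ
firstIdx p [] = nothing
firstIdx p ((i , l) ∷ xs) = if p l then just i else firstIdx p xs

lastIdx : (ℕ → Bool) → List (ℕ × ℕ) → Maybe ℕ
lastIdx p [] = nothing
lastIdx p ((i , l) ∷ xs) with lastIdx p xs
... | just j = just j
... | nothing = if p l then just i else nothing

memb : ℕ → List ℕ → Bool
memb j J = any (j ≡ᵇ_) J

-- choice of row j ∈ J for the part m: step (A), else (B1), else (B2)
chooseRow : List ℕ → List ℕ → ℕ → Maybe ℕ
chooseRow la J m =
  let cands = filterᵇ (λ { (i , _) → memb i J }) (rowsOf la) in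
  firstIdx (λ l → l ≡ᵇ m) cands
  <∣> (lastIdx (λ l → (m <ᵇ l) ∧ isOdd (l ∸ m)) cands
  <∣> lastIdx (λ l → m <ᵇ l) cands)

-- run over the parts of μ in order; returns list of (row, number of 0's)
runAlg : List ℕ → List ℕ → List ℕ → Maybe (List (ℕ × ℕ))
runAlg la J [] = just []
runAlg la J (m ∷ ms) with chooseRow la J m
... | nothing = nothing
... | just j = Maybe.map ((j , m) ∷_) (runAlg la (filterᵇ (λ k → not (k ≡ᵇ j)) J) ms)

assigned : ℕ → List (ℕ × ℕ) → ℕ
assigned i [] = 0
assigned i ((j , m) ∷ as) = if i ≡ᵇ j then m else assigned i as

buildZ : List ℕ → List (ℕ × ℕ) → List ℕ
buildZ la as = map (λ { (i , _) → assigned i as }) (rowsOf la)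

algorithmC* : List ℕ → List ℕ → Maybe (List ℕ)
algorithmC* la mu = Maybe.map (buildZ la) (runAlg la (upTo (length la)) mu)

module Submission where

-- An exchange argument over the parts of μ, largest first. If a configuration C puts the current part M
-- into row r while the algorithm chooses row j, exchange the contents of rows r and j of C; row j held
-- either nothing or a smaller part. A row holding 0's and d blank squares contributes 0, 1 or 2 to
-- o_s + 2 e_s according as d is zero, odd or even, and moving one row without 0's from one parity class
-- to the other changes max(o_r, e_r + (e_r + o_r) mod 2) by at most 1. Rules (A), (B1), (B2) choose j so
-- that λ_j − M is zero, or odd, or else λ_r − M is even too, and a case check on parities shows that the
-- exchange never increases κ. Repeating it turns C into C* without increasing κ.

open import Defs
open import Data.Bool using (Bool; true; false; not; _∧_; _xor_; if_then_else_; T)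
import Data.Bool as Bool
open import Data.Bool.Properties using (not-involutive; not-distribˡ-xor; ¬-not; T-≡; T-∧)
open import Data.Empty using (⊥-elim)
open import Data.List using (List; []; _∷_; length; map; filter; filterᵇ; upTo; applyUpTo; zip)
open import Data.List.Membership.Propositional using (_∈_; _∉_)
open import Data.List.Membership.Propositional.Properties
  using (∈-applyUpTo⁺; ∈-applyUpTo⁻; ∈-upTo⁺; ∈-upTo⁻; ∈-filter⁺; ∈-filter⁻; ∈-map⁺; ∈-map⁻)
open import Data.List.Properties
  using (filter-accept; filter-reject; filter-all; map-upTo; map-applyUpTo; map-cong-local)
open import Data.List.Relation.Binary.Permutation.Propositional
  using (_↭_; ↭-refl; ↭-sym; ↭-trans; ↭-reflexive; prep; swap)
import Data.List.Relation.Binary.Permutation.Propositional as ↭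
open import Data.List.Relation.Binary.Permutation.Propositional.Properties
  using (map⁺; filter-↭; drop-∷; ∈-resp-↭)
open import Data.List.Relation.Binary.Pointwise using (Pointwise; []; _∷_; Pointwise-length)
open import Data.List.Relation.Unary.All as All using (All; []; _∷_)
open import Data.List.Relation.Unary.AllPairs using (_∷_)
open import Data.List.Relation.Unary.Any as Any using (here; there)
open import Data.List.Relation.Unary.Any.Properties using (any⁺; any⁻)
import Data.List.Relation.Unary.Linked as Linked
open import Data.List.Relation.Unary.Linked.Properties using (Linked⇒AllPairs)
open import Data.List.Relation.Unary.Unique.Propositional using (Unique)
import Data.List.Relation.Unary.Unique.Propositional.Properties as Unique
open import Data.Maybe using (Maybe; just; nothing; _<∣>_)
import Data.Maybe as Maybe
open import Data.Maybe.Properties using (just-injective)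
open import Data.Nat using (ℕ; zero; suc; _+_; _*_; _∸_; _≤_; _<_; _⊔_; _%_; _≡ᵇ_; _<ᵇ_; z≤n; s≤s; z<s)
open import Data.Nat.DivMod using ([m+n]%n≡m%n)
open import Data.Nat.Properties
open import Algebra.Properties.CommutativeSemigroup +-commutativeSemigroup using (x∙yz≈y∙xz)
open import Data.Nat.Tactic.RingSolver using (solve-∀)
open import Data.List.Membership.DecPropositional _≟_ using (_∈?_)
open import Data.Product using (Σ; Σ-syntax; ∃-syntax; _×_; _,_; proj₁; proj₂)
open import Data.Sum using (_⊎_; inj₁; inj₂)
open import Function using (_∘_; id)
open import Function.Bundles using (Equivalence)
open import Relation.Binary.PropositionalEquality
open import Relation.Nullary using (¬_; yes; no)
open import Relation.Nullary.Decidable using (T?)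

-- Parity and the cost of a row

indicator : Bool → ℕ
indicator b = if b then 1 else 0

parity : ℕ → Bool
parity zero    = false
parity (suc n) = not (parity n)

isOdd≡parity : ∀ n → isOdd n ≡ parity n
isOdd≡parity zero          = refl
isOdd≡parity (suc zero)    = refl
isOdd≡parity (suc (suc n)) = begin
  isOdd (2 + n)   ≡⟨ cong (λ k → k % 2 ≡ᵇ 1) (+-comm 2 n) ⟩
  isOdd (n + 2)   ≡⟨ cong (_≡ᵇ 1) ([m+n]%n≡m%n n 2) ⟩
  isOdd n         ≡⟨ isOdd≡parity n ⟩
  parity n        ≡⟨ sym (not-involutive (parity n)) ⟩
  parity (2 + n)  ∎
  where open ≡-Reasoning

parity-+ : ∀ m n → parity (m + n) ≡ parity m xor parity n
parity-+ zero    n = refl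
parity-+ (suc m) n = trans (cong not (parity-+ m n)) (not-distribˡ-xor (parity m) (parity n))

parity-+ʳ : ∀ m n k → parity m ≡ parity n → parity (m + k) ≡ parity (n + k)
parity-+ʳ m n k eq = trans (parity-+ m k) (trans (cong (_xor parity k) eq) (sym (parity-+ n k)))

parity-∸ : ∀ {m n} → n ≤ m → parity m ≡ parity (m ∸ n) xor parity n
parity-∸ {m} {n} n≤m = trans (cong parity (sym (m∸n+n≡m n≤m))) (parity-+ (m ∸ n) n)

xor-cancelʳ : ∀ x y z → (x xor z) xor (y xor z) ≡ x xor y
xor-cancelʳ true  true  true  = refl
xor-cancelʳ true  true  false = refl
xor-cancelʳ true  false true  = refl
xor-cancelʳ true  false false = refl
xor-cancelʳ false true  true  = refl
xor-cancelʳ false true  false = refl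
xor-cancelʳ false false true  = refl
xor-cancelʳ false false false = refl

-- The contribution to o_s + 2 e_s of a row holding 0's and d blank squares.
usedCost : ℕ → ℕ
usedCost zero    = 0
usedCost (suc d) = if parity (suc d) then 1 else 2

usedCost-spec : ∀ d → indicator (isOdd d) + 2 * indicator (not (isOdd d) ∧ not (d ≡ᵇ 0)) ≡ usedCost d
usedCost-spec zero = refl
usedCost-spec (suc d) rewrite isOdd≡parity (suc d) with parity (suc d)
... | true  = refl
... | false = refl

usedCost≤2 : ∀ d → usedCost d ≤ 2
usedCost≤2 zero = z≤n
usedCost≤2 (suc d) with parity (suc d)
... | true  = s≤s z≤n
... | false = ≤-refl

usedCost-pos : ∀ d → 1 ≤ usedCost (suc d)
usedCost-pos d with parity (suc d)
... | true  = ≤-refl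
... | false = s≤s z≤n

usedCost-odd : ∀ d → parity (suc d) ≡ true → usedCost (suc d) ≡ 1
usedCost-odd d odd rewrite odd = refl

usedCost-even : ∀ d → parity (suc d) ≡ false → usedCost (suc d) ≡ 2
usedCost-even d even rewrite even = refl

usedCost-cong : ∀ d e → parity (suc d) ≡ parity (suc e) → usedCost (suc d) ≡ usedCost (suc e)
usedCost-cong d e eq rewrite eq = refl

-- d ≼ d′: a row with leftover d is at least as good a home for the current part as one with leftover d′.
_≼_ : ℕ → ℕ → Set
d ≼ d′ = d ≡ 0 ⊎ (d′ ≢ 0 × d ≢ 0 × (parity d ≡ true ⊎ parity d′ ≡ false))

usedCost-exchange : ∀ {d d′} k → d ≼ d′ → usedCost d + usedCost (d′ + suc k) ≤ usedCost d′ + usedCost (d + suc k)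
usedCost-exchange {d′ = zero}     k (inj₁ refl) = ≤-refl
usedCost-exchange {d′ = suc d′}   k (inj₁ refl) =
  ≤-trans (usedCost≤2 (suc d′ + suc k)) (+-mono-≤ (usedCost-pos d′) (usedCost-pos k))
usedCost-exchange {zero}           k (inj₂ (_ , d≢0 , _)) = ⊥-elim (d≢0 refl)
usedCost-exchange {suc d} {zero}   k (inj₂ (d′≢0 , _ , _)) = ⊥-elim (d′≢0 refl)
usedCost-exchange {suc d} {suc d′} k (inj₂ (_ , _ , preference)) with parity (suc d) Bool.≟ parity (suc d′)
... | yes same = ≤-reflexive (cong₂ _+_ (usedCost-cong d d′ same)
  (usedCost-cong (d′ + suc k) (d + suc k) (parity-+ʳ (suc d′) (suc d) (suc k) (sym same))))
... | no differ = odd-over-even (oddness preference)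
  where
    oddness : parity (suc d) ≡ true ⊎ parity (suc d′) ≡ false → parity (suc d) ≡ true × parity (suc d′) ≡ false
    oddness (inj₁ odd)   = odd , (¬-not (λ eq → differ (trans odd (sym eq))))
    oddness (inj₂ even′) = ¬-not (λ eq → differ (trans eq (sym even′))) , even′

    odd-over-even : parity (suc d) ≡ true × parity (suc d′) ≡ false →
                    usedCost (suc d) + usedCost (suc d′ + suc k) ≤ usedCost (suc d′) + usedCost (suc d + suc k)
    odd-over-even (odd , even′) = begin
      usedCost (suc d) + usedCost (suc d′ + suc k)  ≡⟨ cong (_+ usedCost (suc d′ + suc k)) (usedCost-odd d odd) ⟩
      1 + usedCost (suc d′ + suc k)                 ≤⟨ s≤s (usedCost≤2 (suc d′ + suc k)) ⟩
      2 + 1                                         ≤⟨ +-monoʳ-≤ 2 (usedCost-pos (d + suc k)) ⟩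
      2 + usedCost (suc d + suc k)                  ≡⟨ cong (_+ usedCost (suc d + suc k)) (sym (usedCost-even d′ even′)) ⟩
      usedCost (suc d′) + usedCost (suc d + suc k)  ∎
      where open ≤-Reasoning

parityGap : Bool → Bool → ℕ
parityGap x y = indicator (x xor y)

usedCost-release : ∀ {d d′} → d ≼ d′ → usedCost d + parityGap (parity d′) (parity d) ≤ usedCost d′
usedCost-release {d′ = zero}       (inj₁ refl) = z≤n
usedCost-release {d′ = suc d′}     (inj₁ refl) with parity (suc d′)
... | true  = ≤-refl
... | false = z≤n
usedCost-release {zero}            (inj₂ (_ , d≢0 , _)) = ⊥-elim (d≢0 refl)
usedCost-release {suc d} {zero}    (inj₂ (d′≢0 , _ , _)) = ⊥-elim (d′≢0 refl)
usedCost-release {suc d} {suc d′}  (inj₂ (_ , _ , preference)) with parity (suc d) | parity (suc d′) | preference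
... | true  | true  | _       = ≤-refl
... | true  | false | _       = ≤-refl
... | false | false | _       = ≤-refl
... | false | true  | inj₁ ()
... | false | true  | inj₂ ()

-- The part of κ contributed by the rows without 0's.
unusedCost : ℕ → ℕ → ℕ
unusedCost o e = o ⊔ (e + (e + o) % 2)

unusedCost-move : ∀ x y o e →
  unusedCost (indicator x + o) (indicator (not x) + e) ≤
  parityGap x y + unusedCost (indicator y + o) (indicator (not y) + e)
unusedCost-move true  true  o e = ≤-refl
unusedCost-move false false o e = ≤-refl
unusedCost-move true  false o e =
  ⊔-monoʳ-≤ (suc o) (≤-trans (≤-reflexive (cong (λ k → e + k % 2) (+-suc e o))) (≤-trans (n≤1+n _) (n≤1+n _)))
unusedCost-move false true  o e =
  ⊔-mono-≤ (≤-trans (n≤1+n o) (n≤1+n _)) (s≤s (≤-reflexive (cong (λ k → e + k % 2) (sym (+-suc e o)))))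

-- κ as a sum over rows

usedWeight oddUnused evenUnused : ℕ → ℕ → ℕ
usedWeight l z =
  indicator (not (z ≡ᵇ 0) ∧ isOdd (l ∸ z)) + 2 * indicator (not (z ≡ᵇ 0) ∧ (not (isOdd (l ∸ z)) ∧ not ((l ∸ z) ≡ᵇ 0)))
oddUnused  l z = indicator ((z ≡ᵇ 0) ∧ isOdd l)
evenUnused l z = indicator ((z ≡ᵇ 0) ∧ not (isOdd l))

usedWeight-suc : ∀ l k → usedWeight l (suc k) ≡ usedCost (l ∸ suc k)
usedWeight-suc l k = usedCost-spec (l ∸ suc k)

∸-split : ∀ {l m n} → n ≤ m → m ≤ l → l ∸ n ≡ (l ∸ m) + (m ∸ n)
∸-split {l} {m} {n} n≤m m≤l = trans (cong (_∸ n) (sym (m∸n+n≡m m≤l))) (+-∸-assoc (l ∸ m) n≤m)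

usedWeight-exchange : ∀ {lr lj m k} → k < m → suc m ≤ lr → suc m ≤ lj → (lj ∸ suc m) ≼ (lr ∸ suc m) →
  usedWeight lj (suc m) + usedWeight lr (suc k) ≤ usedWeight lr (suc m) + usedWeight lj (suc k)
usedWeight-exchange {lr} {lj} {m} {k} k<m M≤lr M≤lj preference = begin
  usedWeight lj (suc m) + usedWeight lr (suc k)
    ≡⟨ cong₂ _+_ (usedWeight-suc lj m) (trans (usedWeight-suc lr k) (cong usedCost (split M≤lr))) ⟩
  usedCost (lj ∸ suc m) + usedCost ((lr ∸ suc m) + suc δ)
    ≤⟨ usedCost-exchange δ preference ⟩
  usedCost (lr ∸ suc m) + usedCost ((lj ∸ suc m) + suc δ)
    ≡⟨ sym (cong₂ _+_ (usedWeight-suc lr m) (trans (usedWeight-suc lj k) (cong usedCost (split M≤lj)))) ⟩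
  usedWeight lr (suc m) + usedWeight lj (suc k)  ∎
  where
    open ≤-Reasoning
    δ = m ∸ suc k
    split : ∀ {l} → suc m ≤ l → l ∸ suc k ≡ (l ∸ suc m) + suc δ
    split {l} M≤l = trans (∸-split (s≤s (<⇒≤ k<m)) M≤l) (cong ((l ∸ suc m) +_) (+-∸-assoc 1 k<m))

usedWeight-release : ∀ {lr lj m} → suc m ≤ lr → suc m ≤ lj → (lj ∸ suc m) ≼ (lr ∸ suc m) →
  usedWeight lj (suc m) + parityGap (isOdd lr) (isOdd lj) ≤ usedWeight lr (suc m)
usedWeight-release {lr} {lj} {m} M≤lr M≤lj preference = begin
  usedWeight lj (suc m) + parityGap (isOdd lr) (isOdd lj)  ≡⟨ cong₂ _+_ (usedWeight-suc lj m) gap ⟩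
  usedCost (lj ∸ suc m) + parityGap (parity (lr ∸ suc m)) (parity (lj ∸ suc m))  ≤⟨ usedCost-release preference ⟩
  usedCost (lr ∸ suc m)  ≡⟨ sym (usedWeight-suc lr m) ⟩
  usedWeight lr (suc m)  ∎
  where
    open ≤-Reasoning
    gap : parityGap (isOdd lr) (isOdd lj) ≡ parityGap (parity (lr ∸ suc m)) (parity (lj ∸ suc m))
    gap = trans (cong₂ parityGap (trans (isOdd≡parity lr) (parity-∸ M≤lr)) (trans (isOdd≡parity lj) (parity-∸ M≤lj)))
                (cong indicator (xor-cancelʳ (parity (lr ∸ suc m)) (parity (lj ∸ suc m)) (parity (suc m))))

-- Running totals (Σ usedWeight, o_r, e_r) over a set of rows, each given as (λ_i , z_i).
Totals : Set
Totals = ℕ × ℕ × ℕ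

withRow : ℕ → ℕ → Totals → Totals
withRow l z (u , o , e) = usedWeight l z + u , oddUnused l z + o , evenUnused l z + e

κ-totals : Totals → ℕ
κ-totals (u , o , e) = u + unusedCost o e

tally : List (ℕ × ℕ) → Totals
tally []             = 0 , 0 , 0
tally ((l , z) ∷ ps) = withRow l z (tally ps)

withRow-comm : ∀ l z l′ z′ t → withRow l z (withRow l′ z′ t) ≡ withRow l′ z′ (withRow l z t)
withRow-comm l z l′ z′ (u , o , e) =
  cong₂ _,_ (x∙yz≈y∙xz (usedWeight l z) (usedWeight l′ z′) u)
    (cong₂ _,_ (x∙yz≈y∙xz (oddUnused l z) (oddUnused l′ z′) o) (x∙yz≈y∙xz (evenUnused l z) (evenUnused l′ z′) e))

tally-↭ : ∀ {ps qs} → ps ↭ qs → tally ps ≡ tally qs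
tally-↭ ↭.refl                          = refl
tally-↭ (prep (l , z) p)                = cong (withRow l z) (tally-↭ p)
tally-↭ (swap (l , z) (l′ , z′) p)      =
  trans (withRow-comm l z l′ z′ _) (cong (withRow l′ z′ ∘ withRow l z) (tally-↭ p))
tally-↭ (↭.trans p q)                   = trans (tally-↭ p) (tally-↭ q)

-- Row r holds the part suc m before the exchange and z after it; row j the other way round.
exchange-pair : ∀ {lr lj m z} t → z ≤ m → suc m ≤ lr → suc m ≤ lj → (lj ∸ suc m) ≼ (lr ∸ suc m) →
  κ-totals (withRow lr z (withRow lj (suc m) t)) ≤ κ-totals (withRow lr (suc m) (withRow lj z t))
exchange-pair {lr} {lj} {m} {zero} (U , O , E) _ M≤lr M≤lj preference = begin
  (usedWeight lj (suc m) + U) + unusedCost (indicator (isOdd lr) + O) (indicator (not (isOdd lr)) + E)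
    ≤⟨ +-monoʳ-≤ _ (unusedCost-move (isOdd lr) (isOdd lj) O E) ⟩
  (usedWeight lj (suc m) + U) + (parityGap (isOdd lr) (isOdd lj) + Fj)
    ≡⟨ regroup (usedWeight lj (suc m)) U (parityGap (isOdd lr) (isOdd lj)) Fj ⟩
  ((usedWeight lj (suc m) + parityGap (isOdd lr) (isOdd lj)) + U) + Fj
    ≤⟨ +-monoˡ-≤ Fj (+-monoˡ-≤ U (usedWeight-release M≤lr M≤lj preference)) ⟩
  (usedWeight lr (suc m) + U) + Fj  ∎
  where
    open ≤-Reasoning
    Fj = unusedCost (indicator (isOdd lj) + O) (indicator (not (isOdd lj)) + E)
    regroup : ∀ a b c d → (a + b) + (c + d) ≡ ((a + c) + b) + d
    regroup = solve-∀
exchange-pair {lr} {lj} {m} {suc k} (U , O , E) k<m M≤lr M≤lj preference = +-monoˡ-≤ (unusedCost O E) (begin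
  r′ + (j + U)  ≡⟨ sym (+-assoc r′ j U) ⟩
  (r′ + j) + U  ≡⟨ cong (_+ U) (+-comm r′ j) ⟩
  (j + r′) + U  ≤⟨ +-monoˡ-≤ U (usedWeight-exchange k<m M≤lr M≤lj preference) ⟩
  (r + j′) + U  ≡⟨ +-assoc r j′ U ⟩
  r + (j′ + U)  ∎)
  where
    open ≤-Reasoning
    r = usedWeight lr (suc m)
    j = usedWeight lj (suc m)
    r′ = usedWeight lr (suc k)
    j′ = usedWeight lj (suc k)

tally-zip : ∀ ls zs → tally (zip ls zs) ≡ (oS ls zs + 2 * eS ls zs , oR ls zs , eR ls zs)
tally-zip []       zs       = refl
tally-zip (l ∷ ls) []       = refl
tally-zip (l ∷ ls) (z ∷ zs) rewrite tally-zip ls zs =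
  cong (_, oR (l ∷ ls) (z ∷ zs) , eR (l ∷ ls) (z ∷ zs))
       (regroup (indicator (not (z ≡ᵇ 0) ∧ isOdd (l ∸ z))) (oS ls zs)
                (indicator (not (z ≡ᵇ 0) ∧ (not (isOdd (l ∸ z)) ∧ not ((l ∸ z) ≡ᵇ 0)))) (eS ls zs))
  where
    regroup : ∀ a b c d → (a + 2 * c) + (b + 2 * d) ≡ (a + b) + 2 * (c + d)
    regroup = solve-∀

κ≡κ-totals : ∀ ls zs → κ ls zs ≡ κ-totals (tally (zip ls zs))
κ≡κ-totals ls zs = cong κ-totals (sym (tally-zip ls zs))

-- The i-th entry of a list, with 0 past its end (rows beyond ℓ(μ) receive no 0's).
entry : List ℕ → ℕ → ℕ
entry []       _       = 0
entry (x ∷ xs) zero    = x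
entry (x ∷ xs) (suc i) = entry xs i

applyUpTo-entry : ∀ xs → applyUpTo (entry xs) (length xs) ≡ xs
applyUpTo-entry []       = refl
applyUpTo-entry (x ∷ xs) = cong (x ∷_) (applyUpTo-entry xs)

pointwise-entry : ∀ {C ls} → Pointwise _≤_ C ls → ∀ {i} → i < length ls → entry C i ≤ entry ls i
pointwise-entry (c≤l ∷ _)  {zero}  _         = c≤l
pointwise-entry (_ ∷ rest) {suc i} (s≤s i<n) = pointwise-entry rest i<n

map-entry-upTo : ∀ {C ls} → Pointwise _≤_ C ls → map (entry C) (upTo (length ls)) ≡ C
map-entry-upTo {C} C≤ls = trans (map-upTo (entry C) _)
  (subst (λ k → applyUpTo (entry C) k ≡ C) (Pointwise-length C≤ls) (applyUpTo-entry C))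

zip-applyUpToʳ : ∀ ls (h : ℕ → ℕ) → zip ls (applyUpTo h (length ls)) ≡ applyUpTo (λ i → entry ls i , h i) (length ls)
zip-applyUpToʳ []       h = refl
zip-applyUpToʳ (l ∷ ls) h = cong ((l , h 0) ∷_) (zip-applyUpToʳ ls (h ∘ suc))

zip-applyUpToˡ : ∀ ls (h : ℕ → ℕ) → zip (applyUpTo h (length ls)) ls ≡ applyUpTo (λ i → h i , entry ls i) (length ls)
zip-applyUpToˡ []       h = refl
zip-applyUpToˡ (l ∷ ls) h = cong ((h 0 , l) ∷_) (zip-applyUpToˡ ls (h ∘ suc))

∈-rowsOf⁻ : ∀ {la i l} → (i , l) ∈ rowsOf la → i < length la × l ≡ entry la i
∈-rowsOf⁻ {la} p with ∈-applyUpTo⁻ (λ i → i , entry la i) (subst (_ ∈_) (zip-applyUpToˡ la id) p)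
... | _ , i<n , refl = i<n , refl

∈-rowsOf⁺ : ∀ {la i} → i < length la → (i , entry la i) ∈ rowsOf la
∈-rowsOf⁺ {la} {i} i<n =
  subst ((i , entry la i) ∈_) (sym (zip-applyUpToˡ la id)) (∈-applyUpTo⁺ (λ i → i , entry la i) i<n)

T-≡ᵇ⇒≡ : ∀ {m n} → T (m ≡ᵇ n) → m ≡ n
T-≡ᵇ⇒≡ {m} {n} = ≡ᵇ⇒≡ m n

T-not-≡ᵇ⇒≢ : ∀ {m n} → T (not (m ≡ᵇ n)) → m ≢ n
T-not-≡ᵇ⇒≢ {m} t refl with m ≡ᵇ m | ≡⇒≡ᵇ m m refl
... | true | _ = t

≢⇒T-not-≡ᵇ : ∀ {m n} → m ≢ n → T (not (m ≡ᵇ n))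
≢⇒T-not-≡ᵇ {m} {n} m≢n with m ≡ᵇ n in eq
... | true  = m≢n (T-≡ᵇ⇒≡ (subst T (sym eq) _))
... | false = _

memb⇒∈ : ∀ {i J} → T (memb i J) → i ∈ J
memb⇒∈ {i} {J} t = Any.map T-≡ᵇ⇒≡ (any⁻ (i ≡ᵇ_) J t)

∈⇒memb : ∀ {i J} → i ∈ J → T (memb i J)
∈⇒memb {i} i∈J = any⁺ (i ≡ᵇ_) (Any.map (λ { refl → ≡⇒≡ᵇ i i refl }) i∈J)

remove : ℕ → List ℕ → List ℕ
remove j = filterᵇ (λ k → not (k ≡ᵇ j))

∈-remove⁻ : ∀ {i j J} → i ∈ remove j J → i ∈ J × i ≢ j
∈-remove⁻ {j = j} p with ∈-filter⁻ (λ k → T? (not (k ≡ᵇ j))) p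
... | i∈J , t = i∈J , T-not-≡ᵇ⇒≢ t

∈-remove⁺ : ∀ {i j J} → i ∈ J → i ≢ j → i ∈ remove j J
∈-remove⁺ {j = j} i∈J i≢j = ∈-filter⁺ (λ k → T? (not (k ≡ᵇ j))) i∈J (≢⇒T-not-≡ᵇ i≢j)

∉-remove : ∀ {j J} → j ∉ remove j J
∉-remove {J = J} p = proj₂ (∈-remove⁻ {J = J} p) refl

remove-unique : ∀ {j J} → Unique J → Unique (remove j J)
remove-unique {j} u = Unique.filter⁺ (λ k → T? (not (k ≡ᵇ j))) u

remove-↭ : ∀ {j J} → Unique J → j ∈ J → J ↭ j ∷ remove j J
remove-↭ {j} {x ∷ xs} (x∉xs ∷ _) (here refl) = prep x (↭-reflexive (sym (begin
  remove x (x ∷ xs)  ≡⟨ filter-reject P? {x} {xs} (λ t → T-not-≡ᵇ⇒≢ {x} t refl) ⟩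
  remove x xs        ≡⟨ filter-all P? (All.map (λ x≢k → ≢⇒T-not-≡ᵇ (≢-sym x≢k)) x∉xs) ⟩
  xs                 ∎)))
  where
    open ≡-Reasoning
    P? = λ k → T? (not (k ≡ᵇ x))
remove-↭ {j} {x ∷ xs} (x∉xs ∷ u) (there j∈xs) = begin
  x ∷ xs                  ↭⟨ prep x (remove-↭ u j∈xs) ⟩
  x ∷ j ∷ remove j xs     ↭⟨ swap x j ↭-refl ⟩
  j ∷ x ∷ remove j xs     ≡⟨ cong (j ∷_) (sym (filter-accept P? (≢⇒T-not-≡ᵇ (All.lookup x∉xs j∈xs)))) ⟩
  j ∷ remove j (x ∷ xs)   ∎
  where
    open ↭.PermutationReasoning
    P? = λ k → T? (not (k ≡ᵇ j))

-- The row chosen by the algorithm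

firstIdx-just : ∀ p xs {j} → firstIdx p xs ≡ just j → ∃[ l ] (j , l) ∈ xs × T (p l)
firstIdx-just p ((i , l) ∷ xs) eq with p l in pl | eq
... | true  | refl = l , here refl , Equivalence.from T-≡ pl
... | false | eq′ with firstIdx-just p xs eq′
...   | l′ , l′∈xs , t = l′ , there l′∈xs , t

firstIdx-nothing : ∀ p xs → firstIdx p xs ≡ nothing → ∀ {i l} → (i , l) ∈ xs → ¬ T (p l)
firstIdx-nothing p ((i , l) ∷ xs) eq i∈ with p l in pl | eq | i∈
... | true  | () | _
... | false | _   | here refl = subst T pl
... | false | eq′ | there i∈xs = firstIdx-nothing p xs eq′ i∈xs

lastIdx-just : ∀ p xs {j} → lastIdx p xs ≡ just j → ∃[ l ] (j , l) ∈ xs × T (p l)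
lastIdx-just p ((i , l) ∷ xs) eq with lastIdx p xs in later
... | just _ with eq
...   | refl with lastIdx-just p xs later
...     | l′ , l′∈xs , t = l′ , there l′∈xs , t
lastIdx-just p ((i , l) ∷ xs) eq | nothing with p l in pl | eq
... | true  | refl = l , here refl , Equivalence.from T-≡ pl
... | false | ()

lastIdx-nothing : ∀ p xs → lastIdx p xs ≡ nothing → ∀ {i l} → (i , l) ∈ xs → ¬ T (p l)
lastIdx-nothing p ((i , l) ∷ xs) eq i∈ with lastIdx p xs in later
lastIdx-nothing p ((i , l) ∷ xs) () i∈ | just _
... | nothing with p l in pl
lastIdx-nothing p ((i , l) ∷ xs) () i∈ | nothing | true
lastIdx-nothing p ((i , l) ∷ xs) eq (here refl) | nothing | false = subst T pl
lastIdx-nothing p ((i , l) ∷ xs) eq (there i∈xs) | nothing | false = lastIdx-nothing p xs later i∈xs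

-- chooseRow la J m is choice applied to the rows (i , λ_i) with i ∈ J.
choice : List (ℕ × ℕ) → ℕ → Maybe ℕ
choice cs m =
  firstIdx (λ l → l ≡ᵇ m) cs
  <∣> (lastIdx (λ l → (m <ᵇ l) ∧ isOdd (l ∸ m)) cs
  <∣> lastIdx (λ l → m <ᵇ l) cs)

no-exact-fit : ∀ cs m → firstIdx (λ l → l ≡ᵇ m) cs ≡ nothing → ∀ {i l} → (i , l) ∈ cs → m ≤ l → m < l
no-exact-fit cs m none i∈ m≤l = ≤∧≢⇒< m≤l (firstIdx-nothing _ cs none i∈ ∘ ≡⇒≡ᵇ _ m ∘ sym)

choice-nothing : ∀ cs m → choice cs m ≡ nothing → ∀ {i l} → (i , l) ∈ cs → l < m
choice-nothing cs m eq i∈ with firstIdx (λ l → l ≡ᵇ m) cs in exact | eq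
... | just _  | ()
... | nothing | eq′ with lastIdx (λ l → (m <ᵇ l) ∧ isOdd (l ∸ m)) cs | eq′
...   | just _  | ()
...   | nothing | eq″ = ≰⇒> (λ m≤l → lastIdx-nothing _ cs eq″ i∈ (<⇒<ᵇ (no-exact-fit cs m exact i∈ m≤l)))

choice-just : ∀ cs m {j} → choice cs m ≡ just j →
  ∃[ l ] (j , l) ∈ cs × m ≤ l × (∀ {i l′} → (i , l′) ∈ cs → m ≤ l′ → (l ∸ m) ≼ (l′ ∸ m))
choice-just cs m eq with firstIdx (λ l → l ≡ᵇ m) cs in exact | eq
... | just _ | refl with firstIdx-just _ cs exact
...   | l , j∈cs , t = l , j∈cs , ≤-reflexive (sym l≡m) , λ _ _ → inj₁ (trans (cong (_∸ m) l≡m) (n∸n≡0 m))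
  where l≡m = ≡ᵇ⇒≡ l m t
choice-just cs m eq | nothing | eq′ with lastIdx (λ l → (m <ᵇ l) ∧ isOdd (l ∸ m)) cs in odd | eq′
... | just _  | refl with lastIdx-just _ cs odd
...   | l , j∈cs , t with Equivalence.to T-∧ t
...     | m<ᵇl , oddᵇ = l , j∈cs , <⇒≤ m<l , λ i∈ m≤l′ →
          inj₂ (m>n⇒m∸n≢0 (no-exact-fit cs m exact i∈ m≤l′) , m>n⇒m∸n≢0 m<l ,
                inj₁ (trans (sym (isOdd≡parity (l ∸ m))) (Equivalence.to T-≡ oddᵇ)))
  where m<l = <ᵇ⇒< m l m<ᵇl
choice-just cs m eq | nothing | _ | nothing | eq″ with lastIdx-just _ cs eq″
...   | l , j∈cs , m<ᵇl = l , j∈cs , <⇒≤ m<l , λ i∈ m≤l′ →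
          inj₂ (m>n⇒m∸n≢0 (no-exact-fit cs m exact i∈ m≤l′) , m>n⇒m∸n≢0 m<l , inj₂ (even i∈ m≤l′))
  where
    m<l = <ᵇ⇒< m l m<ᵇl
    even : ∀ {i l′} → (i , l′) ∈ cs → m ≤ l′ → parity (l′ ∸ m) ≡ false
    even {l′ = l′} i∈ m≤l′ = trans (sym (isOdd≡parity (l′ ∸ m))) (¬-not λ oddᵇ →
      lastIdx-nothing _ cs odd i∈ (Equivalence.from T-∧ (<⇒<ᵇ (no-exact-fit cs m exact i∈ m≤l′) , Equivalence.from T-≡ oddᵇ)))

-- Defs selects the rows of J with a pattern lambda, which cannot be named here; it is abstracted as q
-- and recovered by unification in chooseRow-just and chooseRow-nothing.
module Candidates {la J : List ℕ} (q : ℕ × ℕ → Bool) (q-memb : ∀ i l → q (i , l) ≡ memb i J) where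

  ∈-candidates⁻ : ∀ {i l} → (i , l) ∈ filterᵇ q (rowsOf la) → i ∈ J × i < length la × l ≡ entry la i
  ∈-candidates⁻ {i} {l} p with ∈-filter⁻ (T? ∘ q) {xs = rowsOf la} p
  ... | i∈rows , t with ∈-rowsOf⁻ {la} i∈rows
  ...   | i<n , l≡ = memb⇒∈ (subst T (q-memb i l) t) , i<n , l≡

  ∈-candidates⁺ : ∀ {i} → i ∈ J → i < length la → (i , entry la i) ∈ filterᵇ q (rowsOf la)
  ∈-candidates⁺ {i} i∈J i<n =
    ∈-filter⁺ (T? ∘ q) (∈-rowsOf⁺ {la} i<n) (subst T (sym (q-memb i (entry la i))) (∈⇒memb i∈J))

  choice-candidates-nothing : ∀ {m} → choice (filterᵇ q (rowsOf la)) m ≡ nothing →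
    ∀ {r} → r ∈ J → r < length la → entry la r < m
  choice-candidates-nothing {m} eq r∈J r<n = choice-nothing _ m eq (∈-candidates⁺ r∈J r<n)

  choice-candidates-just : ∀ {m j} → choice (filterᵇ q (rowsOf la)) m ≡ just j →
    j ∈ J × j < length la × m ≤ entry la j ×
    (∀ {r} → r ∈ J → r < length la → m ≤ entry la r → (entry la j ∸ m) ≼ (entry la r ∸ m))
  choice-candidates-just {m} eq with choice-just _ m eq
  ... | l , j∈cs , m≤l , best with ∈-candidates⁻ j∈cs
  ...   | j∈J , j<n , refl = j∈J , j<n , m≤l , λ r∈J r<n → best (∈-candidates⁺ r∈J r<n)

chooseRow-nothing : ∀ {la J m} → chooseRow la J m ≡ nothing → ∀ {r} → r ∈ J → r < length la → entry la r < m
chooseRow-nothing {la} {J} = Candidates.choice-candidates-nothing {la} {J} _ (λ _ _ → refl)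

chooseRow-just : ∀ {la J m j} → chooseRow la J m ≡ just j →
  j ∈ J × j < length la × m ≤ entry la j ×
  (∀ {r} → r ∈ J → r < length la → m ≤ entry la r → (entry la j ∸ m) ≼ (entry la r ∸ m))
chooseRow-just {la} {J} = Candidates.choice-candidates-just {la} {J} _ (λ _ _ → refl)

update : (ℕ → ℕ) → ℕ → ℕ → ℕ → ℕ
update g j v i = if i ≡ᵇ j then v else g i

update-same : ∀ g j v → update g j v j ≡ v
update-same g j v with j ≡ᵇ j | ≡⇒≡ᵇ j j refl
... | true | _ = refl

update-other : ∀ g {i j} v → i ≢ j → update g j v i ≡ g i
update-other g {i} {j} v i≢j with i ≡ᵇ j | ≢⇒T-not-≡ᵇ i≢j
... | false | _ = refl

swapRows : (ℕ → ℕ) → ℕ → ℕ → ℕ → ℕ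
swapRows g r j = update (update g r (g j)) j (g r)

swapRows-at-j : ∀ g r j → swapRows g r j j ≡ g r
swapRows-at-j g r j = update-same (update g r (g j)) j (g r)

swapRows-at-r : ∀ g {r j} → r ≢ j → swapRows g r j r ≡ g j
swapRows-at-r g {r} {j} r≢j = trans (update-other (update g r (g j)) (g r) r≢j) (update-same g r (g j))

swapRows-elsewhere : ∀ g {r j i} → i ≢ r → i ≢ j → swapRows g r j i ≡ g i
swapRows-elsewhere g {r} {j} i≢r i≢j = trans (update-other (update g r (g j)) (g r) i≢j) (update-other g (g j) i≢r)

remove-↭₂ : ∀ {J r j} → Unique J → r ∈ J → j ∈ J → j ≢ r → J ↭ r ∷ j ∷ remove j (remove r J)
remove-↭₂ {J} {r} {j} u r∈J j∈J j≢r =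
  ↭-trans (remove-↭ u r∈J) (prep r (remove-↭ (remove-unique {r} u) (∈-remove⁺ {j} {r} {J} j∈J j≢r)))

∈-remove₂⁻ : ∀ {J r j i} → i ∈ remove j (remove r J) → i ≢ r × i ≢ j
∈-remove₂⁻ {J} {r} {j} i∈ with ∈-remove⁻ {J = remove r J} i∈
... | i∈′ , i≢j = proj₂ (∈-remove⁻ {J = J} i∈′) , i≢j

map-swapRows-↭ : ∀ g {J r j} → Unique J → r ∈ J → j ∈ J → r ≢ j → map (swapRows g r j) J ↭ map g J
map-swapRows-↭ g {J} {r} {j} u r∈J j∈J r≢j = begin
  map (swapRows g r j) J                        ↭⟨ map⁺ _ split ⟩
  swapRows g r j r ∷ swapRows g r j j ∷ map (swapRows g r j) rest
    ≡⟨ cong₂ _∷_ (swapRows-at-r g r≢j) (cong₂ _∷_ (swapRows-at-j g r j) unchanged) ⟩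
  g j ∷ g r ∷ map g rest                        ↭⟨ swap (g j) (g r) ↭-refl ⟩
  map g (r ∷ j ∷ rest)                          ↭⟨ map⁺ g (↭-sym split) ⟩
  map g J                                       ∎
  where
    open ↭.PermutationReasoning
    rest = remove j (remove r J)
    split = remove-↭₂ u r∈J j∈J (r≢j ∘ sym)
    unchanged : map (swapRows g r j) rest ≡ map g rest
    unchanged = map-cong-local (All.tabulate λ i∈ →
      swapRows-elsewhere g (proj₁ (∈-remove₂⁻ {J} i∈)) (proj₂ (∈-remove₂⁻ {J} i∈)))

positives : List ℕ → List ℕ
positives = filter (0 <?_)

∈-positives⁻ : ∀ {g : ℕ → ℕ} {J v} → v ∈ positives (map g J) → ∃[ r ] r ∈ J × g r ≡ v
∈-positives⁻ {g} {J} v∈ with ∈-map⁻ g (proj₁ (∈-filter⁻ (0 <?_) {xs = map g J} v∈))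
... | r , r∈J , refl = r , r∈J , refl

∈-positives⁺ : ∀ {g : ℕ → ℕ} {J j} → j ∈ J → 0 < g j → g j ∈ positives (map g J)
∈-positives⁺ {g} j∈J pos = ∈-filter⁺ (0 <?_) (∈-map⁺ g j∈J) pos

positives-↭[] : ∀ {g : ℕ → ℕ} {J} → positives (map g J) ↭ [] → ∀ {i} → i ∈ J → g i ≡ 0
positives-↭[] {g} {J} none {i} i∈J with g i in gi
... | zero  = refl
... | suc _ with ∈-resp-↭ none (subst (_∈ positives (map g J)) gi (∈-positives⁺ {g} i∈J (subst (0 <_) (sym gi) z<s)))
...   | ()

-- The exchange induction

strict-tail : ∀ {m ms} → StrictPartition (m ∷ ms) → StrictPartition ms
strict-tail (decreasing , _ ∷ positive) = Linked.tail decreasing , positive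

strict-below-head : ∀ {m ms x} → StrictPartition (m ∷ ms) → x ∈ ms → x < m
strict-below-head (decreasing , _) x∈ms with Linked⇒AllPairs (λ p q → <-trans q p) decreasing
... | below ∷ _ = All.lookup below x∈ms

runAlg-chosen : ∀ {la J m ms j} → chooseRow la J m ≡ just j →
  runAlg la J (m ∷ ms) ≡ Maybe.map ((j , m) ∷_) (runAlg la (remove j J) ms)
runAlg-chosen chosen rewrite chosen = refl

pointwise-applyUpTo : ∀ ls (h : ℕ → ℕ) → (∀ {i} → i < length ls → h i ≤ entry ls i) →
  Pointwise _≤_ (applyUpTo h (length ls)) ls
pointwise-applyUpTo []       h h≤ = []
pointwise-applyUpTo (l ∷ ls) h h≤ = h≤ z<s ∷ pointwise-applyUpTo ls (h ∘ suc) (h≤ ∘ s≤s)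

buildZ≡ : ∀ la steps → buildZ la steps ≡ map (λ i → assigned i steps) (upTo (length la))
buildZ≡ la steps = begin
  buildZ la steps                                           ≡⟨ cong (map _) (zip-applyUpToˡ la id) ⟩
  map _ (applyUpTo (λ i → i , entry la i) (length la))      ≡⟨ map-applyUpTo _ _ (length la) ⟩
  applyUpTo (λ i → assigned i steps) (length la)            ≡⟨ sym (map-upTo _ (length la)) ⟩
  map (λ i → assigned i steps) (upTo (length la))           ∎
  where open ≡-Reasoning

module Optimality (la : List ℕ) where

  L : ℕ → ℕ
  L = entry la

  n : ℕ
  n = length la

  rowsWith : (ℕ → ℕ) → List ℕ → List (ℕ × ℕ)
  rowsWith g = map (λ i → L i , g i)

  κ-of : (ℕ → ℕ) → ℕ
  κ-of g = κ-totals (tally (rowsWith g (upTo n)))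

  κ≡κ-of : ∀ g → κ la (map g (upTo n)) ≡ κ-of g
  κ≡κ-of g = trans (κ≡κ-totals la (map g (upTo n))) (cong (κ-totals ∘ tally) (begin
    zip la (map g (upTo n))         ≡⟨ cong (zip la) (map-upTo g n) ⟩
    zip la (applyUpTo g n)          ≡⟨ zip-applyUpToʳ la g ⟩
    applyUpTo (λ i → L i , g i) n   ≡⟨ sym (map-upTo _ n) ⟩
    rowsWith g (upTo n)             ∎))
    where open ≡-Reasoning

  κ-of-cong : ∀ {g h} → (∀ {i} → i < n → g i ≡ h i) → κ-of g ≡ κ-of h
  κ-of-cong g≡h = cong (κ-totals ∘ tally) (map-cong-local (All.tabulate λ i∈ → cong (L _ ,_) (g≡h (∈-upTo⁻ i∈))))

  κ-of-swapRows : ∀ {g r j m} → r < n → j < n → r ≢ j → g r ≡ suc m → g j ≤ m →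
    suc m ≤ L r → suc m ≤ L j → (L j ∸ suc m) ≼ (L r ∸ suc m) → κ-of (swapRows g r j) ≤ κ-of g
  κ-of-swapRows {g} {r} {j} {m} r<n j<n r≢j gr≡M gj≤m M≤Lr M≤Lj preference = begin
    κ-of (swapRows g r j)                                           ≡⟨ cong κ-totals swapped ⟩
    κ-totals (withRow (L r) (g j) (withRow (L j) (suc m) others))   ≤⟨ exchange-pair others gj≤m M≤Lr M≤Lj preference ⟩
    κ-totals (withRow (L r) (suc m) (withRow (L j) (g j) others))   ≡⟨ cong κ-totals original ⟩
    κ-of g                                                          ∎
    where
      open ≤-Reasoning
      rest = remove j (remove r (upTo n))
      others = tally (rowsWith g rest)

      split : ∀ h → tally (rowsWith h (upTo n)) ≡ withRow (L r) (h r) (withRow (L j) (h j) (tally (rowsWith h rest)))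
      split h = tally-↭ (map⁺ _ (remove-↭₂ (Unique.upTo⁺ n) (∈-upTo⁺ r<n) (∈-upTo⁺ j<n) (r≢j ∘ sym)))

      unchanged : rowsWith (swapRows g r j) rest ≡ rowsWith g rest
      unchanged = map-cong-local (All.tabulate λ i∈ →
        cong (L _ ,_) (swapRows-elsewhere g (proj₁ (∈-remove₂⁻ {upTo n} i∈)) (proj₂ (∈-remove₂⁻ {upTo n} i∈))))

      swapped : tally (rowsWith (swapRows g r j) (upTo n)) ≡ withRow (L r) (g j) (withRow (L j) (suc m) others)
      swapped = trans (split (swapRows g r j))
        (cong₂ (withRow (L r)) (swapRows-at-r g r≢j)
               (cong₂ (withRow (L j)) (trans (swapRows-at-j g r j) gr≡M) (cong tally unchanged)))

      original : withRow (L r) (suc m) (withRow (L j) (g j) others) ≡ tally (rowsWith g (upTo n))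
      original = sym (trans (split g) (cong (λ v → withRow (L r) v (withRow (L j) (g j) others)) gr≡M))

  -- Rows outside J are already filled as in g0; g is a competing configuration that agrees with g0 there
  -- and places the remaining parts ms inside J.
  record Invariant (ms J : List ℕ) (g0 g : ℕ → ℕ) : Set where
    field
      strict  : StrictPartition ms
      unique  : Unique J
      inRange : ∀ {i} → i ∈ J → i < n
      blank   : ∀ {i} → i ∈ J → g0 i ≡ 0
      agree   : ∀ {i} → i < n → i ∉ J → g i ≡ g0 i
      fits    : ∀ {i} → i < n → g i ≤ L i
      parts   : positives (map g J) ↭ ms

  fill : (ℕ → ℕ) → List (ℕ × ℕ) → ℕ → ℕ
  fill g0 steps i = g0 i + assigned i steps

  record Outcome (ms J : List ℕ) (g0 g : ℕ → ℕ) : Set where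
    field
      steps   : List (ℕ × ℕ)
      runs    : runAlg la J ms ≡ just steps
      outside : ∀ {i} → i ∉ J → assigned i steps ≡ 0
      fits    : ∀ {i} → i < n → fill g0 steps i ≤ L i
      parts   : positives (map (fill g0 steps) J) ↭ ms
      optimal : κ-of (fill g0 steps) ≤ κ-of g

  outcome-[] : ∀ {J g0 g} → Invariant [] J g0 g → Outcome [] J g0 g
  outcome-[] {J} {g0} {g} inv = record
    { steps   = []
    ; runs    = refl
    ; outside = λ _ → refl
    ; fits    = λ i<n → subst (_≤ L _) (filled i<n) (fits i<n)
    ; parts   = subst (_↭ []) (cong positives (map-cong-local (All.tabulate (filled ∘ inRange)))) parts
    ; optimal = ≤-reflexive (κ-of-cong (sym ∘ filled))
    }
    where
      open Invariant inv
      filled : ∀ {i} → i < n → g i ≡ g0 i + 0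
      filled {i} i<n with i ∈? J
      ... | yes i∈J = trans (positives-↭[] parts i∈J) (sym (cong (_+ 0) (blank i∈J)))
      ... | no i∉J  = trans (agree i<n i∉J) (sym (+-identityʳ (g0 i)))

  part-position : ∀ {M ms J g0 g} → Invariant (M ∷ ms) J g0 g → ∃[ r ] r ∈ J × g r ≡ M
  part-position inv = ∈-positives⁻ (∈-resp-↭ (↭-sym (Invariant.parts inv)) (here refl))

  some-row-fits : ∀ {M ms J g0 g} → Invariant (M ∷ ms) J g0 g → chooseRow la J M ≢ nothing
  some-row-fits inv none with part-position inv
  ... | r , r∈J , gr≡M = <⇒≱ (chooseRow-nothing {la} none r∈J r<n) (subst (_≤ L r) gr≡M (Invariant.fits inv r<n))
    where r<n = Invariant.inRange inv r∈J

  below-current-part : ∀ {m ms J g0 g j} → Invariant (suc m ∷ ms) J g0 g → j ∈ J → g j ≢ suc m → g j ≤ m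
  below-current-part {g = g} {j} inv j∈J gj≢M with 0 <? g j
  ... | no gj≯0 = ≤-trans (≮⇒≥ gj≯0) z≤n
  ... | yes gj>0 with ∈-resp-↭ (Invariant.parts inv) (∈-positives⁺ {g} j∈J gj>0)
  ...   | here same   = ⊥-elim (gj≢M same)
  ...   | there in-ms = ≤-pred (strict-below-head (Invariant.strict inv) in-ms)

  invariant-swapRows : ∀ {m ms J g0 g r j} → Invariant (suc m ∷ ms) J g0 g → r ∈ J → j ∈ J → r ≢ j →
    g r ≡ suc m → g j ≤ m → suc m ≤ L j → Invariant (suc m ∷ ms) J g0 (swapRows g r j)
  invariant-swapRows {m} {ms} {J} {g0} {g} {r} {j} inv r∈J j∈J r≢j gr≡M gj≤m M≤Lj = record
    { strict  = strict
    ; unique  = unique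
    ; inRange = inRange
    ; blank   = blank
    ; agree   = λ i<n i∉J → trans (swapRows-elsewhere g (λ { refl → i∉J r∈J }) (λ { refl → i∉J j∈J })) (agree i<n i∉J)
    ; fits    = fits′
    ; parts   = ↭-trans (filter-↭ (0 <?_) (map-swapRows-↭ g unique r∈J j∈J r≢j)) parts
    }
    where
      open Invariant inv
      fits′ : ∀ {i} → i < n → swapRows g r j i ≤ L i
      fits′ {i} i<n with i ≟ j | i ≟ r
      ... | yes refl | _        = subst (_≤ L i) (sym (trans (swapRows-at-j g r i) gr≡M)) M≤Lj
      ... | no i≢j   | yes refl = subst (_≤ L i) (sym (swapRows-at-r g i≢j))
                                        (≤-trans (m≤n⇒m≤1+n gj≤m) (subst (_≤ L i) gr≡M (fits i<n)))
      ... | no i≢j   | no i≢r   = subst (_≤ L i) (sym (swapRows-elsewhere g i≢r i≢j)) (fits i<n)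

  exchange-toward : ∀ {m ms J g0 g j} → Invariant (suc m ∷ ms) J g0 g → chooseRow la J (suc m) ≡ just j →
    Σ[ g′ ∈ (ℕ → ℕ) ] g′ j ≡ suc m × Invariant (suc m ∷ ms) J g0 g′ × κ-of g′ ≤ κ-of g
  exchange-toward {m} {g = g} {j} inv chosen with chooseRow-just {la} chosen | part-position inv
  ... | j∈J , j<n , M≤Lj , preferred | r , r∈J , gr≡M with g j ≟ suc m
  ...   | yes gj≡M = g , gj≡M , inv , ≤-refl
  ...   | no gj≢M  =
    swapRows g r j , trans (swapRows-at-j g r j) gr≡M , invariant-swapRows inv r∈J j∈J r≢j gr≡M gj≤m M≤Lj ,
    κ-of-swapRows r<n j<n r≢j gr≡M gj≤m M≤Lr M≤Lj (preferred r∈J r<n M≤Lr)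
    where
      r<n = Invariant.inRange inv r∈J
      M≤Lr = subst (_≤ L r) gr≡M (Invariant.fits inv r<n)
      gj≤m = below-current-part inv j∈J gj≢M
      r≢j : r ≢ j
      r≢j refl = gj≢M gr≡M

  invariant-step : ∀ {m ms J g0 g j} → Invariant (suc m ∷ ms) J g0 g → j ∈ J → g j ≡ suc m →
    Invariant ms (remove j J) (update g0 j (suc m)) g
  invariant-step {m} {ms} {J} {g0} {g} {j} inv j∈J gj≡M = record
    { strict  = strict-tail strict
    ; unique  = remove-unique unique
    ; inRange = inRange ∘ proj₁ ∘ ∈-remove⁻ {J = J}
    ; blank   = λ i∈ → let i∈J , i≢j = ∈-remove⁻ {J = J} i∈ in trans (update-other g0 (suc m) i≢j) (blank i∈J)
    ; agree   = agree′
    ; fits    = fits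
    ; parts   = drop-∷ (begin
        suc m ∷ positives (map g (remove j J))  ≡⟨ cong (λ v → positives (v ∷ map g (remove j J))) (sym gj≡M) ⟩
        positives (map g (j ∷ remove j J))      ↭⟨ filter-↭ (0 <?_) (map⁺ g (↭-sym (remove-↭ unique j∈J))) ⟩
        positives (map g J)                     ↭⟨ parts ⟩
        suc m ∷ ms                              ∎)
    }
    where
      open Invariant inv
      open ↭.PermutationReasoning

      agree′ : ∀ {i} → i < n → i ∉ remove j J → g i ≡ update g0 j (suc m) i
      agree′ {i} i<n i∉ with i ≟ j
      ... | yes refl = trans gj≡M (sym (update-same g0 i (suc m)))
      ... | no i≢j   = trans (agree i<n (λ i∈J → i∉ (∈-remove⁺ i∈J i≢j))) (sym (update-other g0 (suc m) i≢j))

  outcome-step : ∀ {m ms J g0 g j} → chooseRow la J (suc m) ≡ just j → Invariant (suc m ∷ ms) J g0 g →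
    Outcome ms (remove j J) (update g0 j (suc m)) g → Outcome (suc m ∷ ms) J g0 g
  outcome-step {m} {ms} {J} {g0} {g} {j} chosen inv o = record
    { steps   = (j , suc m) ∷ steps
    ; runs    = trans (runAlg-chosen {la} {J} chosen) (cong (Maybe.map ((j , suc m) ∷_)) runs)
    ; outside = λ {i} i∉J → trans (update-other (λ k → assigned k steps) (suc m) (λ { refl → i∉J j∈J }))
                                  (outside (i∉J ∘ proj₁ ∘ ∈-remove⁻ {J = J}))
    ; fits    = λ {i} i<n → subst (_≤ L i) (sym (same i)) (fits i<n)
    ; parts   = begin
        positives (map filled J)                           ↭⟨ filter-↭ (0 <?_) (map⁺ filled (remove-↭ unique j∈J)) ⟩
        positives (filled j ∷ map filled (remove j J))
          ≡⟨ cong₂ (λ v vs → positives (v ∷ vs)) (trans (same j) filled-j)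
                   (map-cong-local (All.tabulate λ {i} _ → same i)) ⟩
        suc m ∷ positives (map (fill g0′ steps) (remove j J))  ↭⟨ prep (suc m) parts ⟩
        suc m ∷ ms                                           ∎
    ; optimal = subst (_≤ κ-of g) (κ-of-cong λ {i} _ → sym (same i)) optimal
    }
    where
      open Outcome o
      open Invariant inv using (blank; unique)
      open ↭.PermutationReasoning
      j∈J = proj₁ (chooseRow-just {la} chosen)
      g0′ = update g0 j (suc m)
      filled = fill g0 ((j , suc m) ∷ steps)

      filled-j : fill g0′ steps j ≡ suc m
      filled-j = trans (cong₂ _+_ (update-same g0 j (suc m)) (outside (∉-remove {J = J}))) (+-identityʳ (suc m))

      same : ∀ i → filled i ≡ fill g0′ steps i
      same i with i ≟ j
      ... | yes refl = trans (cong₂ _+_ (blank j∈J) (update-same (λ k → assigned k steps) i (suc m))) (sym filled-j)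
      ... | no i≢j = cong₂ _+_ (sym (update-other g0 (suc m) i≢j)) (update-other (λ k → assigned k steps) (suc m) i≢j)


  outcome-≤ : ∀ {ms J g0 g′ g} → Outcome ms J g0 g′ → κ-of g′ ≤ κ-of g → Outcome ms J g0 g
  outcome-≤ o improves = record { Outcome o hiding (optimal) ; optimal = ≤-trans (Outcome.optimal o) improves }

  run : ∀ {ms J g0 g} → Invariant ms J g0 g → Outcome ms J g0 g
  run {[]} inv = outcome-[] inv
  run {zero ∷ ms} inv with Invariant.strict inv
  ... | _ , () ∷ _
  run {suc m ∷ ms} {J} inv with chooseRow la J (suc m) in chosen
  ... | nothing = ⊥-elim (some-row-fits inv chosen)
  ... | just j with exchange-toward inv chosen
  ...   | g′ , g′j≡M , inv′ , improves =
    outcome-≤ (outcome-step chosen inv′ (run (invariant-step inv′ j∈J g′j≡M))) improves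
    where j∈J = proj₁ (chooseRow-just {la} chosen)

  configuration-invariant : ∀ {mu C} → StrictPartition mu → IsConfiguration la mu C →
    Invariant mu (upTo n) (λ _ → 0) (entry C)
  configuration-invariant {mu} {C} strict (C≤λ , C-parts) = record
    { strict  = strict
    ; unique  = Unique.upTo⁺ n
    ; inRange = ∈-upTo⁻
    ; blank   = λ _ → refl
    ; agree   = λ i<n i∉ → ⊥-elim (i∉ (∈-upTo⁺ i<n))
    ; fits    = pointwise-entry C≤λ
    ; parts   = subst (λ xs → positives xs ↭ mu) (sym (map-entry-upTo C≤λ)) C-parts
    }

  κ-entry : ∀ {C} → Pointwise _≤_ C la → κ-of (entry C) ≡ κ la C
  κ-entry {C} C≤λ = trans (sym (κ≡κ-of (entry C))) (cong (κ la) (map-entry-upTo C≤λ))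

  buildZ-configuration : ∀ {mu g} (o : Outcome mu (upTo n) (λ _ → 0) g) →
    IsConfiguration la mu (buildZ la (Outcome.steps o))
  buildZ-configuration {mu} o =
    subst (λ C → Pointwise _≤_ C la) (sym (trans (buildZ≡ la steps) (map-upTo _ n))) (pointwise-applyUpTo la _ fits) ,
    subst (λ C → positives C ↭ mu) (sym (buildZ≡ la steps)) parts
    where open Outcome o

  κ-buildZ : ∀ {mu g} (o : Outcome mu (upTo n) (λ _ → 0) g) → κ la (buildZ la (Outcome.steps o)) ≤ κ-of g
  κ-buildZ {g = g} o =
    subst (_≤ κ-of g) (sym (trans (cong (κ la) (buildZ≡ la steps)) (κ≡κ-of (fill (λ _ → 0) steps)))) optimal
    where open Outcome o

padding-fits : ∀ la mu → mu ⊆ₚ la → Pointwise _≤_ (applyUpTo (entry mu) (length la)) la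
padding-fits []       _        _            = []
padding-fits (l ∷ ls) []       _            = z≤n ∷ padding-fits ls [] []
padding-fits (l ∷ ls) (x ∷ xs) (x≤l ∷ rest) = x≤l ∷ padding-fits ls xs rest

padding-positives : ∀ la mu → mu ⊆ₚ la → All (0 <_) mu → positives (applyUpTo (entry mu) (length la)) ≡ mu
padding-positives []       []           _          _         = refl
padding-positives (l ∷ ls) []           _          _         = padding-positives ls [] [] []
padding-positives (l ∷ ls) (suc k ∷ xs) (_ ∷ rest) (_ ∷ pos) = cong (suc k ∷_) (padding-positives ls xs rest pos)

padding-configuration : ∀ la mu → StrictPartition mu → mu ⊆ₚ la →
  IsConfiguration la mu (applyUpTo (entry mu) (length la))
padding-configuration la mu (_ , positive) μ⊆λ =
  padding-fits la mu μ⊆λ , ↭-reflexive (padding-positives la mu μ⊆λ positive)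

-- The argument never uses that λ is strict.
mainTheorem13 : (la mu : List ℕ) → StrictPartition la → StrictPartition mu → mu ⊆ₚ la →
    Σ (List ℕ) (λ Cstar → (algorithmC* la mu ≡ just Cstar) × IsConfiguration la mu Cstar ×
      ((C : List ℕ) → IsConfiguration la mu C → κ la Cstar ≤ κ la C))
mainTheorem13 la mu _ μ-strict μ⊆λ =
  buildZ la steps , cong (Maybe.map (buildZ la)) runs , buildZ-configuration padded , optimal′
  where
    open Optimality la

    outcome : ∀ {C} → IsConfiguration la mu C → Outcome mu (upTo n) (λ _ → 0) (entry C)
    outcome = run ∘ configuration-invariant μ-strict

    padded = outcome (padding-configuration la mu μ-strict μ⊆λ)
    open Outcome padded

    optimal′ : (C : List ℕ) → IsConfiguration la mu C → κ la (buildZ la steps) ≤ κ la C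
    optimal′ C conf = begin
      κ la (buildZ la steps)              ≡⟨ cong (κ la ∘ buildZ la) (just-injective (trans (sym runs) (Outcome.runs o))) ⟩
      κ la (buildZ la (Outcome.steps o))  ≤⟨ κ-buildZ o ⟩
      κ-of (entry C)                      ≡⟨ κ-entry (proj₁ conf) ⟩
      κ la C                              ∎
      where
        open ≤-Reasoning
        o = outcome conf
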